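{- Let $x\in\mathcal{P}_1$. Then the morphism $\phi:\{1,2,\dots,n_x\}^+\to\mathbb{A}^+$ obtained by extending $\phi$ multiplicatively is injective.
   Context: $x$ is an infinite word over a finite alphabet $\mathbb{A}$. A finite non-empty word is unbordered if no non-empty word other than itself is both a prefix and a suffix of it; $UP(x)$ is the set of non-empty unbordered prefixes of $x$. $\mathcal{P}_1$ is the set of infinite words admitting a prefixal factorization (a factorization $x=V_0V_1\cdots$ with each $V_i$ a non-empty prefix of $x$); each $x\in\mathcal{P}_1$ has a unique factorization $x=U_0U_1\cdots$ with $U_i\in UP(x)$. Let $UP'(x)=\{U_i:i\ge0\}$, $n_x=\mathrm{card}(UP'(x))$, order $UP'(x)$ by index of first occurrence in this factorization, and let $\phi:\{1,\dots,n_x\}\to UP'(x)$ be the order-preserving bijection. -}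

module Defs where

open import Data.Nat using (ℕ; zero; suc; _+_)
open import Data.Fin using (Fin; toℕ)
open import Data.Fin.Properties using (all?)
open import Data.List using (List; []; _∷_; _++_; length; lookup; concat)
open import Data.List.Properties using (≡-dec)
open import Data.List.Relation.Binary.Pointwise using (Pointwise)
open import Data.Product using (Σ; ∃; _×_; _,_)
open import Relation.Binary.PropositionalEquality using (_≡_; _≢_)
open import Relation.Nullary using (Dec; yes; no; ¬?)
open import Relation.Binary.Definitions using (DecidableEquality)
import Data.Fin.Properties as FinP

-- The finite alphabet 𝔸 is modelled as Fin k (any finite alphabet is
-- in bijection with some Fin k).  Infinite words are ℕ → Fin k, finite
-- words are List (Fin k).

module _ {k : ℕ} where

  Word : Set
  Word = List (Fin k)

  InfWord : Set
  InfWord = ℕ → Fin k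

  IsPrefixOf : Word → InfWord → Set
  IsPrefixOf w x = (j : Fin (length w)) → lookup w j ≡ x (toℕ j)

  IsListPrefix : Word → Word → Set
  IsListPrefix u w = ∃ λ v → u ++ v ≡ w

  IsListSuffix : Word → Word → Set
  IsListSuffix u w = ∃ λ v → v ++ u ≡ w

  Unbordered : Word → Set
  Unbordered w = (w ≢ []) ×
    ((u : Word) → u ≢ [] → IsListPrefix u w → IsListSuffix u w → u ≡ w)

  InUP : InfWord → Word → Set
  InUP x w = Unbordered w × IsPrefixOf w x

  pos : (ℕ → Word) → ℕ → ℕ
  pos V zero = 0
  pos V (suc i) = pos V i + length (V i)

  -- x = V₀ V₁ V₂ ⋯  (factors required non-empty, so they cover x)
  Factorizes : InfWord → (ℕ → Word) → Set
  Factorizes x V = (i : ℕ) → (V i ≢ []) ×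
    ((j : Fin (length (V i))) → lookup (V i) j ≡ x (pos V i + toℕ j))

  IsPrefixalFactorization : InfWord → (ℕ → Word) → Set
  IsPrefixalFactorization x V = Factorizes x V × ((i : ℕ) → IsPrefixOf (V i) x)

  InP1 : InfWord → Set
  InP1 x = ∃ λ V → IsPrefixalFactorization x V

  IsUPFactorization : InfWord → (ℕ → Word) → Set
  IsUPFactorization x U = Factorizes x U × ((i : ℕ) → InUP x (U i))

  FirstOcc : (ℕ → Word) → ℕ → Set
  FirstOcc U i = (j : Fin i) → U (toℕ j) ≢ U i

  firstOcc? : (U : ℕ → Word) → (i : ℕ) → Dec (FirstOcc U i)
  firstOcc? U i = all? (λ j → ¬? (≡-dec FinP._≟_ (U (toℕ j)) (U i)))

  newCount : (ℕ → Word) → ℕ → ℕ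
  newCount U zero = 0
  newCount U (suc i) with firstOcc? U i
  ... | yes _ = suc (newCount U i)
  ... | no _  = newCount U i

  -- φ as a (functional) relation: Phi U m w  iff  φ(m+1) = w, i.e. w is
  -- the (m+1)-th distinct element of UP'(x) in order of first occurrence.
  -- (Letters are 0-indexed: letter m ∈ {0,…,n_x - 1} stands for m+1.)
  -- Its domain is exactly {m | m < n_x} (n_x possibly infinite).
  Phi : (ℕ → Word) → ℕ → Word → Set
  Phi U m w = ∃ λ i → FirstOcc U i × (newCount U i ≡ m) × (U i ≡ w)

  PhiMorphismInjective : (ℕ → Word) → Set
  PhiMorphismInjective U =
    (ms ms' : List ℕ) (ws ws' : List Word) →
    ms ≢ [] → ms' ≢ [] →
    Pointwise (Phi U) ms ws → Pointwise (Phi U) ms' ws' →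
    concat ws ≡ concat ws' → ms ≡ ms'

-- Proof idea: UP(x) is a code.  If two products of unbordered prefixes of x
-- agree, their first factors w, w' are comparable, say w' = w e with e ≠ [].
-- Reading the rest of the first product factor by factor, the still
-- unmatched part of w' is always a non-empty proper suffix of w', and it is
-- eventually covered by one factor; being then a prefix of a prefix of x, it
-- is a border of w', contradicting that w' is unbordered.  So w = w', and by
-- cancellation the two factorizations coincide.  Finally φ is injective on
-- letters, because distinct first occurrences carry distinct words.
module Submission where

open import Defs
open import Data.Nat using (ℕ; suc; _≤_; s≤s)
open import Data.Nat.Properties using (m≤n+m; <-cmp)
open import Data.Fin using (Fin; zero; suc; fromℕ<)
open import Data.Fin.Properties using (toℕ-fromℕ<)
open import Data.List using (List; []; _∷_; _++_; length; concat)
open import Data.List.Properties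
  using (∷-injective; ++-identityʳ; ++-identityˡ-unique; ++-conicalˡ; ++-cancelˡ; ++-assoc; length-++)
open import Data.List.Relation.Unary.All as All using (All; []; _∷_)
open import Data.List.Relation.Binary.Pointwise
  using (Pointwise; []; _∷_; Pointwise-≡⇒≡; transitive; symmetric)
open import Data.Product using (∃; _×_; _,_; proj₁; proj₂)
open import Data.Sum using (_⊎_; inj₁; inj₂)
open import Data.Empty using (⊥; ⊥-elim)
open import Function using (_∘_; id)
open import Relation.Binary.Definitions using (tri<; tri≈; tri>)
open import Relation.Binary.PropositionalEquality
  using (_≡_; _≢_; refl; sym; trans; cong; cong₂; subst)
open import Relation.Nullary using (¬_)

++-equidivisible : ∀ {a} {A : Set a} (u v u' v' : List A) → u ++ v ≡ u' ++ v' →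
  (∃ λ e → u ++ e ≡ u' × v ≡ e ++ v') ⊎ (∃ λ e → u' ++ e ≡ u × v' ≡ e ++ v)
++-equidivisible []      v u'       v' eq = inj₁ (u' , refl , eq)
++-equidivisible (a ∷ u) v []       v' eq = inj₂ (a ∷ u , refl , sym eq)
++-equidivisible (a ∷ u) v (b ∷ u') v' eq with ∷-injective eq
... | refl , eq′ with ++-equidivisible u v u' v' eq′
... | inj₁ (e , u++e≡u' , v≡e++v') = inj₁ (e , cong (a ∷_) u++e≡u' , v≡e++v')
... | inj₂ (e , u'++e≡u , v'≡e++v) = inj₂ (e , cong (a ∷_) u'++e≡u , v'≡e++v)

module _ {k : ℕ} where

  IsPrefixOf-tail : ∀ x {a} {u : List (Fin k)} → IsPrefixOf (a ∷ u) x → IsPrefixOf u (x ∘ suc)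
  IsPrefixOf-tail x p j = p (suc j)

  IsPrefixOf-++ˡ : ∀ x (u : List (Fin k)) {v : List (Fin k)} → IsPrefixOf (u ++ v) x → IsPrefixOf u x
  IsPrefixOf-++ˡ x (a ∷ u) p zero    = p zero
  IsPrefixOf-++ˡ x (a ∷ u) p (suc j) = IsPrefixOf-++ˡ (x ∘ suc) u (IsPrefixOf-tail x p) j

  prefixes-comparable : ∀ x (u v : List (Fin k)) → IsPrefixOf u x → IsPrefixOf v x →
    length u ≤ length v → IsListPrefix u v
  prefixes-comparable x []      v       _  _  _         = v , refl
  prefixes-comparable x (a ∷ u) (b ∷ v) pu pv (s≤s u≤v)
    with prefixes-comparable (x ∘ suc) u v (IsPrefixOf-tail x pu) (IsPrefixOf-tail x pv) u≤v
  ... | t , u++t≡v = t , cong₂ _∷_ (trans (pu zero) (sym (pv zero))) u++t≡v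

  proper-suffix-of-UP-not-prefix : ∀ x {w} (p t : List (Fin k)) → InUP x w → p ++ t ≡ w →
    p ≢ [] → t ≢ [] → ¬ IsPrefixOf t x
  proper-suffix-of-UP-not-prefix x p t ((_ , unbordered) , pw) refl p≢[] t≢[] pt =
    p≢[] (++-identityˡ-unique p (unbordered t t≢[] t-prefix (p , refl)))
    where
    t-prefix : IsListPrefix t (p ++ t)
    t-prefix = prefixes-comparable x t (p ++ t) pt pw
      (subst (length t ≤_) (sym (length-++ p)) (m≤n+m (length t) (length p)))

  -- p ++ t is the part of w already matched, resp. not yet matched, by a
  -- product of prefixes of x that is supposed to start with t.
  proper-suffix-of-UP-not-prefix-of-product : ∀ x {w s} (p t : List (Fin k)) (vs : List (List (Fin k))) →
    InUP x w → p ++ t ≡ w → All (λ v → IsPrefixOf v x) vs → p ≢ [] → t ≢ [] →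
    concat vs ≡ t ++ s → ⊥
  proper-suffix-of-UP-not-prefix-of-product _ {s = s} p t [] _ _ _ _ t≢[] eq =
    t≢[] (++-conicalˡ t s (sym eq))
  proper-suffix-of-UP-not-prefix-of-product x {s = s} p t (v ∷ vs) uw p++t≡w (pv ∷ pvs) p≢[] t≢[] eq
    with ++-equidivisible v (concat vs) t s eq
  ... | inj₂ (e , t++e≡v , _) =
    proper-suffix-of-UP-not-prefix x p t uw p++t≡w p≢[] t≢[]
      (IsPrefixOf-++ˡ x t (subst (λ z → IsPrefixOf z x) (sym t++e≡v) pv))
  ... | inj₁ ([] , v++[]≡t , _) =
    proper-suffix-of-UP-not-prefix x p t uw p++t≡w p≢[] t≢[]
      (subst (λ z → IsPrefixOf z x) (trans (sym (++-identityʳ v)) v++[]≡t) pv)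
  ... | inj₁ (e@(_ ∷ _) , v++e≡t , eq′) =
    proper-suffix-of-UP-not-prefix-of-product x (p ++ v) e vs uw
      (trans (++-assoc p v e) (trans (cong (p ++_) v++e≡t) p++t≡w)) pvs
      (p≢[] ∘ ++-conicalˡ p v) (λ ()) eq′

  UP-heads-equal : ∀ x {w w'} (vs vs' : List (List (Fin k))) → InUP x w → InUP x w' →
    All (λ v → IsPrefixOf v x) vs → All (λ v → IsPrefixOf v x) vs' →
    w ++ concat vs ≡ w' ++ concat vs' → w ≡ w'
  UP-heads-equal x {w} {w'} vs vs' uw uw' pvs pvs' eq
    with ++-equidivisible w (concat vs) w' (concat vs') eq
  ... | inj₁ ([] , w++[]≡w' , _) = trans (sym (++-identityʳ w)) w++[]≡w'
  ... | inj₂ ([] , w'++[]≡w , _) = trans (sym w'++[]≡w) (++-identityʳ w')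
  ... | inj₁ (e@(_ ∷ _) , w++e≡w' , eq′) = ⊥-elim
    (proper-suffix-of-UP-not-prefix-of-product x w e vs uw' w++e≡w' pvs (proj₁ (proj₁ uw)) (λ ()) eq′)
  ... | inj₂ (e@(_ ∷ _) , w'++e≡w , eq′) = ⊥-elim
    (proper-suffix-of-UP-not-prefix-of-product x w' e vs' uw w'++e≡w pvs' (proj₁ (proj₁ uw')) (λ ()) eq′)

  UP-unique-factorization : ∀ x (ws ws' : List (List (Fin k))) →
    All (InUP x) ws → All (InUP x) ws' → concat ws ≡ concat ws' → ws ≡ ws'
  UP-unique-factorization x []       []         _ _ _ = refl
  UP-unique-factorization x []       (w' ∷ ws') _ (((w'≢[] , _) , _) ∷ _) eq =
    ⊥-elim (w'≢[] (++-conicalˡ w' (concat ws') (sym eq)))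
  UP-unique-factorization x (w ∷ ws) []         (((w≢[] , _) , _) ∷ _) _ eq =
    ⊥-elim (w≢[] (++-conicalˡ w (concat ws) eq))
  UP-unique-factorization x (w ∷ ws) (w' ∷ ws') (uw ∷ uws) (uw' ∷ uws') eq
    with UP-heads-equal x ws ws' uw uw' (All.map proj₂ uws) (All.map proj₂ uws') eq
  ... | refl = cong (w ∷_) (UP-unique-factorization x ws ws' uws uws' (++-cancelˡ w _ _ eq))

module _ {k : ℕ} (U : ℕ → List (Fin k)) where

  FirstOcc-unique : ∀ {i i'} → FirstOcc U i → FirstOcc U i' → U i ≡ U i' → i ≡ i'
  FirstOcc-unique {i} {i'} first first' Ui≡Ui' with <-cmp i i'
  ... | tri≈ _ i≡i' _ = i≡i'
  ... | tri< i<i' _ _ = ⊥-elim (first' (fromℕ< i<i') (trans (cong U (toℕ-fromℕ< i<i')) Ui≡Ui'))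
  ... | tri> _ _ i'<i = ⊥-elim (first (fromℕ< i'<i) (trans (cong U (toℕ-fromℕ< i'<i)) (sym Ui≡Ui')))

  Phi-injective : ∀ {m m' w} → Phi U m w → Phi U m' w → m ≡ m'
  Phi-injective (i , first , refl , Ui≡w) (i' , first' , refl , Ui'≡w)
    with FirstOcc-unique first first' (trans Ui≡w (sym Ui'≡w))
  ... | refl = refl

  Phi-images-UP : ∀ x {ms ws} → ((i : ℕ) → InUP x (U i)) → Pointwise (Phi U) ms ws → All (InUP x) ws
  Phi-images-UP x U-UP []                        = []
  Phi-images-UP x U-UP ((i , _ , _ , refl) ∷ φs) = U-UP i ∷ Phi-images-UP x U-UP φs

-- The hypothesis x ∈ 𝒫₁ only serves to guarantee that U exists.
mainTheorem9 : (k : ℕ) (x : ℕ → Fin k) → InP1 x →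
    (U : ℕ → List (Fin k)) → IsUPFactorization x U →
    PhiMorphismInjective U
mainTheorem9 k x _ U (_ , U-UP) ms ms' ws ws' _ _ φms φms' concat-ws≡concat-ws' =
  Pointwise-≡⇒≡ (transitive (Phi-injective U) φms (symmetric id φms″))
  where
  ws≡ws' : ws ≡ ws'
  ws≡ws' = UP-unique-factorization x ws ws'
    (Phi-images-UP U x U-UP φms) (Phi-images-UP U x U-UP φms') concat-ws≡concat-ws'

  φms″ : Pointwise (Phi U) ms' ws
  φms″ = subst (Pointwise (Phi U) ms') (sym ws≡ws') φms'
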